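{- Let $(X,\Pi)$ be a $d$-dimensional weighted pure simplicial complex, $0\le k\le d$, and $f\in C_k$, with Bottom-Up level functions $g_i\in C_i$ and lifts $f_i=\binom{k}{i}U^k_ig_i\in C_k$. Then: (1) $f=\sum_{i=0}^kf_i$; (2) for every $0\le i\le k$, \[ g_i=\sum_{j=0}^i(-1)^{i-j}\binom{i}{j}U^i_jD^k_jf,\qquad f_i=\binom{k}{i}\sum_{j=0}^i(-1)^{i-j}\binom{i}{j}U^k_jD^k_jf; \] equivalently, for all $\tau\in X(i)$, $g_i(\tau)=\sum_{\sigma\subseteq\tau}(-1)^{|\tau\setminus\sigma|}\mathbb{E}_{X_\sigma}[f]$, and for all $\tau\in X(k)$, $f_i(\tau)=\sum_{\sigma\in X(i),\sigma\subseteq\tau}g_i(\sigma)$.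
   Context: A $d$-dimensional pure simplicial complex $X$ on $[n]$: a nonempty $X(d)\subseteq\binom{[n]}{d}$ with downward closure $X(i)=\{s\in\binom{[n]}{i}:\exists t\in X(d),s\subseteq t\}$ (an $i$-face has $i$ elements). Weighted: distribution $\pi_d=\Pi$ on $X(d)$, $\pi_i(x)=\frac{1}{i+1}\sum_{y\in X(i+1),y\supset x}\pi_{i+1}(y)$. $C_i$: functions $X(i)\to\mathbb{R}$. $U_i:C_i\to C_{i+1}$, $U_if(\tau)=\frac{1}{i+1}\sum_{\sigma\in X(i),\sigma\subset\tau}f(\sigma)$; $D_{i+1}:C_{i+1}\to C_i$, $D_{i+1}f(\tau)=\sum_{\sigma\in X(i+1),\sigma\supset\tau}\pi_{i+1}(\sigma)f(\sigma)/\sum_{\sigma\in X(i+1),\sigma\supset\tau}\pi_{i+1}(\sigma)$. For $j\le i$: $U^i_j=U_{i-1}\circ\cdots\circ U_j:C_j\to C_i$, $D^i_j=D_{j+1}\circ\cdots\circ D_i:C_i\to C_j$ (identity if $i=j$). For $f\in C_k$ and $\sigma\in X(j)$, $\mathbb{E}_{X_\sigma}[f]=D^k_jf(\sigma)$, the $\pi_k$-weighted average of $f$ over $k$-faces containing $\sigma$. The Bottom-Up level functions of $f\in C_k$ are defined recursively by $g_i=D^k_if-\sum_{j=0}^{i-1}\binom{i}{j}U^i_jg_j$. -}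

module Defs where

open import Level using (Level; _⊔_) renaming (suc to lsuc)
open import Data.Bool using (Bool; true; false; if_then_else_; _∧_)
open import Data.Nat as ℕ using (ℕ; zero; suc; _∸_; _≤_; _≤?_)
open import Data.Nat.Combinatorics using (_C_)
open import Data.List using (List; []; _∷_; [_]; map; _++_; foldr)
open import Data.List.Relation.Unary.Any using (Any; any?)
open import Data.Vec using ([]; _∷_)
open import Data.Fin.Subset using (Subset; ∣_∣; _⊆_; inside; outside)
open import Data.Fin.Subset.Properties using (_⊆?_)
open import Data.Product using (_×_)
open import Relation.Nullary using (¬_)
open import Relation.Nullary.Decidable using (⌊_⌋; _×-dec_)
open import Relation.Binary.Core using (Rel)
open import Relation.Binary.Structures using (IsStrictTotalOrder)
open import Relation.Binary.PropositionalEquality using (_≡_)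
open import Algebra.Bundles using (CommutativeRing)

-- The scalars of C_i and the weights
-- live in an arbitrary ordered field.  The inverse is total; its value
-- at 0 is unconstrained, only x * x⁻¹ ≈ 1 for x ≉ 0 is assumed.

record OrderedField (c ℓ₁ ℓ₂ : Level) : Set (lsuc (c ⊔ ℓ₁ ⊔ ℓ₂)) where
  field
    commutativeRing : CommutativeRing c ℓ₁
  open CommutativeRing commutativeRing public
  infix 4 _<_
  infix 8 _⁻¹
  field
    _<_                : Rel Carrier ℓ₂
    isStrictTotalOrder : IsStrictTotalOrder _≈_ _<_
    +-monoˡ-<          : ∀ {x y} z → x < y → x + z < y + z
    *-pos              : ∀ {x y} → 0# < x → 0# < y → 0# < x * y
    0<1                : 0# < 1#
    _⁻¹                : Carrier → Carrier
    ⁻¹-cong            : ∀ {x y} → x ≈ y → x ⁻¹ ≈ y ⁻¹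
    ⁻¹-inverseʳ        : ∀ x → ¬ (x ≈ 0#) → x * x ⁻¹ ≈ 1#

allSubsets : (n : ℕ) → List (Subset n)
allSubsets zero    = [ [] ]
allSubsets (suc n) = map (inside ∷_) (allSubsets n) ++ map (outside ∷_) (allSubsets n)

-- A pure simplicial complex on [n] is given by its list of top faces
-- 'top' (= X(d)).

module Complex {c ℓ₁ ℓ₂ : Level} (F : OrderedField c ℓ₁ ℓ₂)
               {n : ℕ} (d : ℕ) (top : List (Subset n)) (Π : Subset n → OrderedField.Carrier F) where
  open OrderedField F

  -- s ∈ X(i)  (an i-face has i elements; downward closure of X(d))
  IsFace : ℕ → Subset n → Set
  IsFace i s = (∣ s ∣ ≡ i) × Any (s ⊆_) top

  faceᵇ : ℕ → Subset n → Bool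
  faceᵇ i s = ⌊ (∣ s ∣ ℕ.≟ i) ×-dec any? (s ⊆?_) top ⌋

  IsTop : Subset n → Set
  IsTop = IsFace d

  -- C_i : functions X(i) → F (values off X(i) are never used)
  Fn : Set c
  Fn = Subset n → Carrier

  sumL : List Carrier → Carrier
  sumL = foldr _+_ 0#

  ΣSub : (Subset n → Bool) → (Subset n → Carrier) → Carrier
  ΣSub P h = sumL (map (λ s → if P s then h s else 0#) (allSubsets n))

  ΣFace : ℕ → (Subset n → Bool) → (Subset n → Carrier) → Carrier
  ΣFace i P h = ΣSub (λ s → faceᵇ i s ∧ P s) h

  subᵇ : Subset n → Subset n → Bool
  subᵇ s t = ⌊ s ⊆? t ⌋

  sumTo : ℕ → (ℕ → Carrier) → Carrier
  sumTo zero    h = 0#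
  sumTo (suc m) h = sumTo m h + h m

  ι : ℕ → Carrier
  ι zero    = 0#
  ι (suc m) = 1# + ι m

  sgn : ℕ → Carrier
  sgn zero    = 1#
  sgn (suc m) = - sgn m

  bin : ℕ → ℕ → Carrier
  bin m j = ι (m C j)

  -- π_i : weights on X(i); πfrom g i computes π_i for i = d ∸ g
  πfrom : ℕ → ℕ → Subset n → Carrier
  πfrom zero    i x = Π x
  πfrom (suc g) i x = ι (suc i) ⁻¹ * ΣFace (suc i) (subᵇ x) (πfrom g (suc i))

  π : ℕ → Subset n → Carrier
  π i = πfrom (d ∸ i) i

  U : ℕ → Fn → Fn
  U i h τ = ι (suc i) ⁻¹ * ΣFace i (λ σ → subᵇ σ τ) h

  -- D_{i+1} : C_{i+1} → C_i
  D : ℕ → Fn → Fn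
  D i h τ = ΣFace (suc i) (subᵇ τ) (λ σ → π (suc i) σ * h σ)
          * (ΣFace (suc i) (subᵇ τ) (π (suc i))) ⁻¹

  Upow : ℕ → ℕ → Fn → Fn
  Upow zero    j h = h
  Upow (suc m) j h = Upow m (suc j) (U j h)

  Uˢ : ℕ → ℕ → Fn → Fn
  Uˢ i j = Upow (i ∸ j) j

  Dpow : ℕ → ℕ → Fn → Fn
  Dpow zero    j h = h
  Dpow (suc m) j h = D j (Dpow m (suc j) h)

  Dˢ : ℕ → ℕ → Fn → Fn
  Dˢ i j = Dpow (i ∸ j) j

  E : ℕ → Fn → Subset n → Carrier
  E k h σ = Dˢ k ∣ σ ∣ h σ

  -- Bottom-Up level functions of f ∈ C_k:
  --   g_i = D^k_i f - Σ_{j<i} binom(i,j) U^i_j g_j.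
  -- gUpTo i j = g_j for j ≤ i.
  module BottomUp (k : ℕ) (f : Fn) where
    gUpTo : ℕ → ℕ → Fn
    gUpTo zero    j τ = Dˢ k 0 f τ
    gUpTo (suc i) j τ with j ≤? i
    ... | Relation.Nullary.yes _ = gUpTo i j τ
    ... | Relation.Nullary.no  _ =
          Dˢ k (suc i) f τ - sumTo (suc i) (λ j′ → bin (suc i) j′ * Uˢ (suc i) j′ (gUpTo i j′) τ)

    g : ℕ → Fn
    g i = gUpTo i i

    lift : ℕ → Fn
    lift i τ = bin k i * Uˢ k i (g i) τ

module Submission where

open import Defs
open import Level using (Level)
open import Data.Bool using (true)
open import Data.Nat using (ℕ; suc; _≤_; _∸_)
open import Data.List using (List; [])
open import Data.List.Relation.Unary.All using (All)
open import Data.Fin.Subset using (Subset; ∣_∣; _─_)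
open import Data.Product using (_×_; _,_)
open import Relation.Nullary using (¬_)
open import Relation.Binary.PropositionalEquality using (_≡_)
open import Algebra.Bundles using (CommutativeRing)

-- The key fact is a counting identity for the up operators: for a face τ with |τ| = i and
-- j ≤ i, binom(i, j) · U^i_j h (τ) is the sum of h over the j-faces of τ.  It follows by
-- induction on i − j from the absorption identity for binomial coefficients, since each
-- j-face of τ lies in exactly i − j of the (i − 1)-faces of τ.  Read through it, the defining
-- recursion of the g_i says E_{X_τ}[f] = Σ_{σ ⊆ τ} g_{|σ|}(σ); Möbius inversion on the
-- Boolean lattice below τ (alternating sums over a nontrivial interval vanish) gives the
-- formulas for g_i, and those for f_i follow by linearity of U and U^k_i ∘ U^i_j = U^k_j.
-- The weights never enter, as D^k_j f is only ever treated as an arbitrary function.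

module Binomial where
  open import Data.Nat
  open import Data.Nat.Properties
  open import Data.Nat.Combinatorics
  open import Data.Nat.Tactic.RingSolver using (solve-∀)
  open import Relation.Binary.PropositionalEquality
  open ≡-Reasoning

  [1+k]*[1+n]C[1+k]≡[1+n]*nCk : ∀ n k → suc k * (suc n C suc k) ≡ suc n * (n C k)
  [1+k]*[1+n]C[1+k]≡[1+n]*nCk zero    zero    = refl
  [1+k]*[1+n]C[1+k]≡[1+n]*nCk zero    (suc k) = *-zeroʳ (suc (suc k))
  [1+k]*[1+n]C[1+k]≡[1+n]*nCk (suc n) zero    =
    trans (*-identityˡ _) (trans (nC1≡n (suc (suc n))) (sym (*-identityʳ _)))
  [1+k]*[1+n]C[1+k]≡[1+n]*nCk (suc n) (suc k) = begin
    suc (suc k) * (suc (suc n) C suc (suc k))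
      ≡⟨ cong (suc (suc k) *_) (nCk+nC[k+1]≡[n+1]C[k+1] (suc n) (suc k)) ⟨
    suc (suc k) * (a + b)
      ≡⟨ expand k a b ⟩
    a + (suc k * a + suc (suc k) * b)
      ≡⟨ cong₂ (λ u v → a + (u + v)) ([1+k]*[1+n]C[1+k]≡[1+n]*nCk n k)
                                     ([1+k]*[1+n]C[1+k]≡[1+n]*nCk n (suc k)) ⟩
    a + (suc n * (n C k) + suc n * (n C suc k))
      ≡⟨ cong (a +_) (*-distribˡ-+ (suc n) (n C k) (n C suc k)) ⟨
    a + suc n * (n C k + n C suc k)
      ≡⟨ cong (λ u → a + suc n * u) (nCk+nC[k+1]≡[n+1]C[k+1] n k) ⟩
    suc (suc n) * a ∎
    where
    a = suc n C suc k
    b = suc n C suc (suc k)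
    expand : ∀ x y z → suc (suc x) * (y + z) ≡ y + (suc x * y + suc (suc x) * z)
    expand = solve-∀

  [1+m]*[1+m+j]Cj≡[1+m+j]*[m+j]Cj : ∀ m j → suc m * (suc (m + j) C j) ≡ suc (m + j) * ((m + j) C j)
  [1+m]*[1+m+j]Cj≡[1+m+j]*[m+j]Cj m j = begin
    suc m * (suc (m + j) C j)
      ≡⟨ cong (suc m *_) (nCk≡nC[n∸k] (m≤n+m j (suc m))) ⟩
    suc m * (suc (m + j) C (suc m + j ∸ j))
      ≡⟨ cong (λ u → suc m * (suc (m + j) C u)) (m+n∸n≡m (suc m) j) ⟩
    suc m * (suc (m + j) C suc m)
      ≡⟨ [1+k]*[1+n]C[1+k]≡[1+n]*nCk (m + j) m ⟩
    suc (m + j) * ((m + j) C m)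
      ≡⟨ cong (λ u → suc (m + j) * ((m + j) C u)) (m+n∸n≡m m j) ⟨
    suc (m + j) * ((m + j) C (m + j ∸ j))
      ≡⟨ cong (suc (m + j) *_) (nCk≡nC[n∸k] (m≤n+m j m)) ⟨
    suc (m + j) * ((m + j) C j) ∎

module SubsetBool where
  open import Data.Bool using (Bool; true; false)
  open import Data.Nat using (suc; _+_; _∸_)
  open import Data.Nat.Properties using (+-suc; m+n∸n≡m)
  open import Data.Vec using ([]; _∷_)
  open import Data.Fin.Subset using (Subset; ∣_∣; _─_; inside; outside)
  open import Data.Fin.Subset.Properties using (_⊆?_)
  open import Data.Empty using (⊥-elim)
  open import Relation.Nullary using (¬_)
  open import Relation.Nullary.Decidable using (⌊_⌋; ⌊⌋-map′)
  open import Relation.Binary.PropositionalEquality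

  -- ⌊ p ⊆? q ⌋ does not reduce on cons cells, so inclusion is recomputed by structural
  -- recursion; the recursions on interval sums below rely on this.
  infix 7 _⊆ᵇ_ _≡ᵇ_

  _⊆ᵇ_ : ∀ {n} → Subset n → Subset n → Bool
  []            ⊆ᵇ []            = true
  (outside ∷ p) ⊆ᵇ (_ ∷ q)       = p ⊆ᵇ q
  (inside ∷ p)  ⊆ᵇ (outside ∷ q) = false
  (inside ∷ p)  ⊆ᵇ (inside ∷ q)  = p ⊆ᵇ q

  _≡ᵇ_ : ∀ {n} → Subset n → Subset n → Bool
  []            ≡ᵇ []            = true
  (outside ∷ p) ≡ᵇ (outside ∷ q) = p ≡ᵇ q
  (outside ∷ p) ≡ᵇ (inside ∷ q)  = false
  (inside ∷ p)  ≡ᵇ (outside ∷ q) = false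
  (inside ∷ p)  ≡ᵇ (inside ∷ q)  = p ≡ᵇ q

  ⌊⊆?⌋≡⊆ᵇ : ∀ {n} (p q : Subset n) → ⌊ p ⊆? q ⌋ ≡ p ⊆ᵇ q
  ⌊⊆?⌋≡⊆ᵇ []            []            = refl
  ⌊⊆?⌋≡⊆ᵇ (outside ∷ p) (_ ∷ q)       = trans (⌊⌋-map′ _ _ (p ⊆? q)) (⌊⊆?⌋≡⊆ᵇ p q)
  ⌊⊆?⌋≡⊆ᵇ (inside ∷ p)  (outside ∷ q) = refl
  ⌊⊆?⌋≡⊆ᵇ (inside ∷ p)  (inside ∷ q)  = trans (⌊⌋-map′ _ _ (p ⊆? q)) (⌊⊆?⌋≡⊆ᵇ p q)

  ⊆ᵇ-refl : ∀ {n} (p : Subset n) → p ⊆ᵇ p ≡ true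
  ⊆ᵇ-refl []            = refl
  ⊆ᵇ-refl (outside ∷ p) = ⊆ᵇ-refl p
  ⊆ᵇ-refl (inside ∷ p)  = ⊆ᵇ-refl p

  ⊆ᵇ-trans : ∀ {n} (p q r : Subset n) → p ⊆ᵇ q ≡ true → q ⊆ᵇ r ≡ true → p ⊆ᵇ r ≡ true
  ⊆ᵇ-trans []            []            []            _   _  = refl
  ⊆ᵇ-trans (outside ∷ p) (outside ∷ q) (_ ∷ r)       p⊆q q⊆r = ⊆ᵇ-trans p q r p⊆q q⊆r
  ⊆ᵇ-trans (outside ∷ p) (inside ∷ q)  (inside ∷ r)  p⊆q q⊆r = ⊆ᵇ-trans p q r p⊆q q⊆r
  ⊆ᵇ-trans (inside ∷ p)  (inside ∷ q)  (inside ∷ r)  p⊆q q⊆r = ⊆ᵇ-trans p q r p⊆q q⊆r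
  ⊆ᵇ-trans (outside ∷ p) (inside ∷ q)  (outside ∷ r) _   ()
  ⊆ᵇ-trans (inside ∷ p)  (inside ∷ q)  (outside ∷ r) _   ()
  ⊆ᵇ-trans (inside ∷ p)  (outside ∷ q) (_ ∷ r)       ()  _

  ≡ᵇ⇒≡ : ∀ {n} (p q : Subset n) → p ≡ᵇ q ≡ true → p ≡ q
  ≡ᵇ⇒≡ []            []            _ = refl
  ≡ᵇ⇒≡ (outside ∷ p) (outside ∷ q) e = cong (outside ∷_) (≡ᵇ⇒≡ p q e)
  ≡ᵇ⇒≡ (inside ∷ p)  (inside ∷ q)  e = cong (inside ∷_) (≡ᵇ⇒≡ p q e)

  ∣q─p∣+∣p∣≡∣q∣ : ∀ {n} (p q : Subset n) → p ⊆ᵇ q ≡ true → ∣ q ─ p ∣ + ∣ p ∣ ≡ ∣ q ∣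
  ∣q─p∣+∣p∣≡∣q∣ []            []            _ = refl
  ∣q─p∣+∣p∣≡∣q∣ (outside ∷ p) (outside ∷ q) e = ∣q─p∣+∣p∣≡∣q∣ p q e
  ∣q─p∣+∣p∣≡∣q∣ (outside ∷ p) (inside ∷ q)  e = cong suc (∣q─p∣+∣p∣≡∣q∣ p q e)
  ∣q─p∣+∣p∣≡∣q∣ (inside ∷ p)  (inside ∷ q)  e = trans (+-suc _ _) (cong suc (∣q─p∣+∣p∣≡∣q∣ p q e))

  ∣q─p∣≡∣q∣∸∣p∣ : ∀ {n} (p q : Subset n) → p ⊆ᵇ q ≡ true → ∣ q ─ p ∣ ≡ ∣ q ∣ ∸ ∣ p ∣
  ∣q─p∣≡∣q∣∸∣p∣ p q p⊆q =
    trans (sym (m+n∸n≡m ∣ q ─ p ∣ ∣ p ∣)) (cong (_∸ ∣ p ∣) (∣q─p∣+∣p∣≡∣q∣ p q p⊆q))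

  p⊆ᵇq∧∣q─p∣≡0⇒p≡ᵇq : ∀ {n} (p q : Subset n) → p ⊆ᵇ q ≡ true → ∣ q ─ p ∣ ≡ 0 → p ≡ᵇ q ≡ true
  p⊆ᵇq∧∣q─p∣≡0⇒p≡ᵇq []            []            _ _ = refl
  p⊆ᵇq∧∣q─p∣≡0⇒p≡ᵇq (outside ∷ p) (outside ∷ q) e z = p⊆ᵇq∧∣q─p∣≡0⇒p≡ᵇq p q e z
  p⊆ᵇq∧∣q─p∣≡0⇒p≡ᵇq (inside ∷ p)  (inside ∷ q)  e z = p⊆ᵇq∧∣q─p∣≡0⇒p≡ᵇq p q e z

  p⊈ᵇq⇒p≢ᵇq : ∀ {n} (p q : Subset n) → p ⊆ᵇ q ≡ false → p ≡ᵇ q ≡ false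
  p⊈ᵇq⇒p≢ᵇq p q p⊈q with p ≡ᵇ q in p≡q
  ... | false = refl
  ... | true with ≡ᵇ⇒≡ p q p≡q
  ... | refl with trans (sym p⊈q) (⊆ᵇ-refl p)
  ... | ()

  ∣p∣≢∣q∣⇒p≢ᵇq : ∀ {n} (p q : Subset n) → ¬ (∣ p ∣ ≡ ∣ q ∣) → p ≡ᵇ q ≡ false
  ∣p∣≢∣q∣⇒p≢ᵇq p q ∣p∣≢∣q∣ with p ≡ᵇ q in p≡q
  ... | false = refl
  ... | true  = ⊥-elim (∣p∣≢∣q∣ (cong ∣_∣ (≡ᵇ⇒≡ p q p≡q)))

module Sums {c ℓ} (R : CommutativeRing c ℓ) where
  open CommutativeRing R
  open import Algebra.Properties.Ring ring using (-0#≈0#; -‿+-comm)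
  open import Algebra.Properties.CommutativeSemigroup +-commutativeSemigroup using (interchange)
  open import Data.Bool using (Bool; true; false; if_then_else_; _∧_)
  open import Data.Nat using (zero)
  open import Data.Vec using ([]; _∷_)
  open import Data.List using (_∷_; map; _++_; foldr)
  open import Data.Fin.Subset using (inside; outside)
  import Relation.Binary.PropositionalEquality as ≡
  open import Relation.Binary.Reasoning.Setoid setoid
  open SubsetBool

  ΣList : {A : Set} → List A → (A → Carrier) → Carrier
  ΣList xs φ = foldr _+_ 0# (map φ xs)

  ΣList-cong : {A : Set} (xs : List A) {φ ψ : A → Carrier} → (∀ x → φ x ≈ ψ x) → ΣList xs φ ≈ ΣList xs ψ
  ΣList-cong []       φ≈ψ = refl
  ΣList-cong (x ∷ xs) φ≈ψ = +-cong (φ≈ψ x) (ΣList-cong xs φ≈ψ)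

  ΣList-zero : {A : Set} (xs : List A) → ΣList xs (λ _ → 0#) ≈ 0#
  ΣList-zero []       = refl
  ΣList-zero (x ∷ xs) = trans (+-identityˡ _) (ΣList-zero xs)

  ΣList-+ : {A : Set} (xs : List A) (φ ψ : A → Carrier) → ΣList xs (λ x → φ x + ψ x) ≈ ΣList xs φ + ΣList xs ψ
  ΣList-+ []       φ ψ = sym (+-identityˡ 0#)
  ΣList-+ (x ∷ xs) φ ψ = trans (+-congˡ (ΣList-+ xs φ ψ)) (interchange _ _ _ _)

  ΣList-*ˡ : {A : Set} (xs : List A) (a : Carrier) (φ : A → Carrier) → ΣList xs (λ x → a * φ x) ≈ a * ΣList xs φ
  ΣList-*ˡ []       a φ = sym (zeroʳ a)
  ΣList-*ˡ (x ∷ xs) a φ = trans (+-congˡ (ΣList-*ˡ xs a φ)) (sym (distribˡ a _ _))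

  ΣList-neg : {A : Set} (xs : List A) (φ : A → Carrier) → ΣList xs (λ x → - φ x) ≈ - ΣList xs φ
  ΣList-neg []       φ = sym -0#≈0#
  ΣList-neg (x ∷ xs) φ = trans (+-congˡ (ΣList-neg xs φ)) (-‿+-comm _ _)

  ΣList-++ : {A : Set} (xs ys : List A) (φ : A → Carrier) → ΣList (xs ++ ys) φ ≈ ΣList xs φ + ΣList ys φ
  ΣList-++ []       ys φ = sym (+-identityˡ _)
  ΣList-++ (x ∷ xs) ys φ = trans (+-congˡ (ΣList-++ xs ys φ)) (sym (+-assoc _ _ _))

  ΣList-map : {A B : Set} (g : A → B) (xs : List A) (φ : B → Carrier) → ΣList (map g xs) φ ≡ ΣList xs (λ x → φ (g x))
  ΣList-map g []       φ = ≡.refl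
  ΣList-map g (x ∷ xs) φ = ≡.cong (φ (g x) +_) (ΣList-map g xs φ)

  ΣList-swap : {A B : Set} (xs : List A) (ys : List B) (h : A → B → Carrier) →
               ΣList xs (λ a → ΣList ys (h a)) ≈ ΣList ys (λ b → ΣList xs (λ a → h a b))
  ΣList-swap []       ys h = sym (ΣList-zero ys)
  ΣList-swap (x ∷ xs) ys h = trans (+-congˡ (ΣList-swap xs ys h)) (sym (ΣList-+ ys (h x) _))

  ΣSubsets : ∀ {n} → (Subset n → Carrier) → Carrier
  ΣSubsets {n} = ΣList (allSubsets n)

  ΣSubsets-split : ∀ {n} (φ : Subset (suc n) → Carrier) →
                   ΣSubsets φ ≈ ΣSubsets (λ s → φ (inside ∷ s)) + ΣSubsets (λ s → φ (outside ∷ s))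
  ΣSubsets-split {n} φ = begin
    ΣList (map (inside ∷_) (allSubsets n) ++ map (outside ∷_) (allSubsets n)) φ
      ≈⟨ ΣList-++ (map (inside ∷_) (allSubsets n)) _ φ ⟩
    ΣList (map (inside ∷_) (allSubsets n)) φ + ΣList (map (outside ∷_) (allSubsets n)) φ
      ≡⟨ ≡.cong₂ _+_ (ΣList-map (inside ∷_) (allSubsets n) φ) (ΣList-map (outside ∷_) (allSubsets n) φ) ⟩
    ΣSubsets (λ s → φ (inside ∷ s)) + ΣSubsets (λ s → φ (outside ∷ s)) ∎

  ΣSubsets-cong : ∀ {n} {φ ψ : Subset n → Carrier} → (∀ s → φ s ≈ ψ s) → ΣSubsets φ ≈ ΣSubsets ψ
  ΣSubsets-cong {n} = ΣList-cong (allSubsets n)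

  ΣSubsets-zero : ∀ n → ΣSubsets {n} (λ _ → 0#) ≈ 0#
  ΣSubsets-zero n = ΣList-zero (allSubsets n)

  ΣSubsets-*ˡ : ∀ {n} (a : Carrier) (φ : Subset n → Carrier) → ΣSubsets (λ s → a * φ s) ≈ a * ΣSubsets φ
  ΣSubsets-*ˡ {n} = ΣList-*ˡ (allSubsets n)

  ΣSubsets-*ʳ : ∀ {n} (a : Carrier) (φ : Subset n → Carrier) → ΣSubsets (λ s → φ s * a) ≈ ΣSubsets φ * a
  ΣSubsets-*ʳ {n} a φ = trans (ΣSubsets-cong {n} (λ _ → *-comm _ a)) (trans (ΣSubsets-*ˡ a φ) (*-comm a _))

  ΣSubsets-swap : ∀ {n} (h : Subset n → Subset n → Carrier) →
                  ΣSubsets (λ s → ΣSubsets (h s)) ≈ ΣSubsets (λ t → ΣSubsets (λ s → h s t))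
  ΣSubsets-swap {n} = ΣList-swap (allSubsets n) (allSubsets n)

  ΣSubsets-≡ᵇ : ∀ {n} (τ : Subset n) (h : Subset n → Carrier) → ΣSubsets (λ ρ → if ρ ≡ᵇ τ then h ρ else 0#) ≈ h τ
  ΣSubsets-≡ᵇ {zero}  []            h = +-identityʳ _
  ΣSubsets-≡ᵇ {suc n} (inside ∷ τ)  h = begin
    _ ≈⟨ ΣSubsets-split {n} _ ⟩
    ΣSubsets (λ ρ → if ρ ≡ᵇ τ then h (inside ∷ ρ) else 0#) + ΣSubsets {n} (λ _ → 0#)
      ≈⟨ +-cong (ΣSubsets-≡ᵇ τ (λ ρ → h (inside ∷ ρ))) (ΣSubsets-zero n) ⟩
    h (inside ∷ τ) + 0# ≈⟨ +-identityʳ _ ⟩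
    h (inside ∷ τ) ∎
  ΣSubsets-≡ᵇ {suc n} (outside ∷ τ) h = begin
    _ ≈⟨ ΣSubsets-split {n} _ ⟩
    ΣSubsets {n} (λ _ → 0#) + ΣSubsets (λ ρ → if ρ ≡ᵇ τ then h (outside ∷ ρ) else 0#)
      ≈⟨ +-cong (ΣSubsets-zero n) (ΣSubsets-≡ᵇ τ (λ ρ → h (outside ∷ ρ))) ⟩
    0# + h (outside ∷ τ) ≈⟨ +-identityˡ _ ⟩
    h (outside ∷ τ) ∎

  if-cong : (b : Bool) {x y : Carrier} → (b ≡ true → x ≈ y) → (if b then x else 0#) ≈ (if b then y else 0#)
  if-cong true  x≈y = x≈y ≡.refl
  if-cong false _   = refl

  if-zero : (b : Bool) → (if b then 0# else 0#) ≈ 0#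
  if-zero true  = refl
  if-zero false = refl

  if-∧-false : (b : Bool) (x : Carrier) → (if b ∧ false then x else 0#) ≈ 0#
  if-∧-false true  x = refl
  if-∧-false false x = refl

  if-*ˡ : (b : Bool) (a x : Carrier) → a * (if b then x else 0#) ≈ (if b then a * x else 0#)
  if-*ˡ true  a x = refl
  if-*ˡ false a x = zeroʳ a

  if-neg : (b : Bool) (x : Carrier) → (if b then - x else 0#) ≈ - (if b then x else 0#)
  if-neg true  x = refl
  if-neg false x = sym -0#≈0#

  if-ΣSubsets : ∀ {n} (b : Bool) (φ : Subset n → Carrier) →
                (if b then ΣSubsets φ else 0#) ≈ ΣSubsets (λ s → if b then φ s else 0#)
  if-ΣSubsets     true  φ = refl
  if-ΣSubsets {n} false φ = sym (ΣSubsets-zero n)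

  intervalSum : ∀ {n} → (ℕ → Carrier) → Subset n → Subset n → Carrier
  intervalSum φ σ τ = ΣSubsets (λ ρ → if σ ⊆ᵇ ρ ∧ ρ ⊆ᵇ τ then φ ∣ τ ─ ρ ∣ else 0#)

  module _ {n : ℕ} (φ : ℕ → Carrier) (σ τ : Subset n) where

    intervalSum-outside-outside : intervalSum φ (outside ∷ σ) (outside ∷ τ) ≈ intervalSum φ σ τ
    intervalSum-outside-outside = begin
      _ ≈⟨ ΣSubsets-split {n} _ ⟩
      ΣSubsets (λ ρ → if σ ⊆ᵇ ρ ∧ false then φ ∣ τ ─ ρ ∣ else 0#) + intervalSum φ σ τ
        ≈⟨ +-congʳ (ΣSubsets-cong (λ ρ → if-∧-false (σ ⊆ᵇ ρ) _)) ⟩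
      ΣSubsets {n} (λ _ → 0#) + intervalSum φ σ τ ≈⟨ +-congʳ (ΣSubsets-zero n) ⟩
      0# + intervalSum φ σ τ ≈⟨ +-identityˡ _ ⟩
      intervalSum φ σ τ ∎

    intervalSum-inside-inside : intervalSum φ (inside ∷ σ) (inside ∷ τ) ≈ intervalSum φ σ τ
    intervalSum-inside-inside =
      trans (ΣSubsets-split {n} _) (trans (+-congˡ (ΣSubsets-zero n)) (+-identityʳ _))

    intervalSum-outside-inside :
      intervalSum φ (outside ∷ σ) (inside ∷ τ) ≈ intervalSum φ σ τ + intervalSum (λ r → φ (suc r)) σ τ
    intervalSum-outside-inside = ΣSubsets-split {n} _

    intervalSum-neg : intervalSum (λ r → - φ r) σ τ ≈ - intervalSum φ σ τ
    intervalSum-neg = trans (ΣSubsets-cong (λ ρ → if-neg (σ ⊆ᵇ ρ ∧ ρ ⊆ᵇ τ) _)) (ΣList-neg (allSubsets n) _)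

    intervalSum-⊈ : σ ⊆ᵇ τ ≡ false → intervalSum φ σ τ ≈ 0#
    intervalSum-⊈ σ⊈τ = trans (ΣSubsets-cong empty) (ΣSubsets-zero n)
      where
      empty : ∀ ρ → (if σ ⊆ᵇ ρ ∧ ρ ⊆ᵇ τ then φ ∣ τ ─ ρ ∣ else 0#) ≈ 0#
      empty ρ with σ ⊆ᵇ ρ in σ⊆ρ | ρ ⊆ᵇ τ in ρ⊆τ
      ... | false | _     = refl
      ... | true  | false = refl
      ... | true  | true  with ≡.trans (≡.sym (⊆ᵇ-trans σ ρ τ σ⊆ρ ρ⊆τ)) σ⊈τ
      ... | ()

  δ₀ : ℕ → Carrier
  δ₀ zero    = 1#
  δ₀ (suc _) = 0#

  δ₁ : ℕ → Carrier
  δ₁ zero    = 0#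
  δ₁ (suc r) = δ₀ r

  intervalSum-δ₀ : ∀ {n} (σ τ : Subset n) → σ ⊆ᵇ τ ≡ true → intervalSum δ₀ σ τ ≈ 1#
  intervalSum-δ₀ []            []            _   = +-identityʳ _
  intervalSum-δ₀ (outside ∷ σ) (outside ∷ τ) σ⊆τ =
    trans (intervalSum-outside-outside δ₀ σ τ) (intervalSum-δ₀ σ τ σ⊆τ)
  intervalSum-δ₀ (inside ∷ σ)  (inside ∷ τ)  σ⊆τ =
    trans (intervalSum-inside-inside δ₀ σ τ) (intervalSum-δ₀ σ τ σ⊆τ)
  intervalSum-δ₀ {suc n} (outside ∷ σ) (inside ∷ τ)  σ⊆τ = begin
    intervalSum δ₀ (outside ∷ σ) (inside ∷ τ)  ≈⟨ intervalSum-outside-inside δ₀ σ τ ⟩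
    intervalSum δ₀ σ τ + intervalSum (λ _ → 0#) σ τ
      ≈⟨ +-cong (intervalSum-δ₀ σ τ σ⊆τ)
                (trans (ΣSubsets-cong (λ ρ → if-zero (σ ⊆ᵇ ρ ∧ ρ ⊆ᵇ τ))) (ΣSubsets-zero n)) ⟩
    1# + 0#  ≈⟨ +-identityʳ 1# ⟩
    1# ∎

  intervalSum-δ₁ : ∀ {n} (ι : ℕ → Carrier) → ι 0 ≈ 0# → (∀ m → ι (suc m) ≈ 1# + ι m) →
                   (σ τ : Subset n) → σ ⊆ᵇ τ ≡ true → intervalSum δ₁ σ τ ≈ ι ∣ τ ─ σ ∣
  intervalSum-δ₁ ι ι0 ι-suc []            []            _   = trans (+-identityʳ _) (sym ι0)
  intervalSum-δ₁ ι ι0 ι-suc (outside ∷ σ) (outside ∷ τ) σ⊆τ =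
    trans (intervalSum-outside-outside δ₁ σ τ) (intervalSum-δ₁ ι ι0 ι-suc σ τ σ⊆τ)
  intervalSum-δ₁ ι ι0 ι-suc (inside ∷ σ)  (inside ∷ τ)  σ⊆τ =
    trans (intervalSum-inside-inside δ₁ σ τ) (intervalSum-δ₁ ι ι0 ι-suc σ τ σ⊆τ)
  intervalSum-δ₁ ι ι0 ι-suc (outside ∷ σ) (inside ∷ τ)  σ⊆τ = begin
    intervalSum δ₁ (outside ∷ σ) (inside ∷ τ)  ≈⟨ intervalSum-outside-inside δ₁ σ τ ⟩
    intervalSum δ₁ σ τ + intervalSum δ₀ σ τ
      ≈⟨ +-cong (intervalSum-δ₁ ι ι0 ι-suc σ τ σ⊆τ) (intervalSum-δ₀ σ τ σ⊆τ) ⟩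
    ι ∣ τ ─ σ ∣ + 1#  ≈⟨ +-comm _ 1# ⟩
    1# + ι ∣ τ ─ σ ∣  ≈⟨ ι-suc _ ⟨
    ι (suc ∣ τ ─ σ ∣) ∎

  module _ (sg : ℕ → Carrier) (sg0 : sg 0 ≈ 1#) (sg-suc : ∀ m → sg (suc m) ≈ - sg m) where

    intervalSum-alternating : ∀ {n} (σ τ : Subset n) → σ ⊆ᵇ τ ≡ true →
                              intervalSum sg σ τ ≈ (if σ ≡ᵇ τ then 1# else 0#)
    intervalSum-alternating []            []            _   = trans (+-identityʳ _) sg0
    intervalSum-alternating (outside ∷ σ) (outside ∷ τ) σ⊆τ =
      trans (intervalSum-outside-outside sg σ τ) (intervalSum-alternating σ τ σ⊆τ)
    intervalSum-alternating (inside ∷ σ)  (inside ∷ τ)  σ⊆τ =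
      trans (intervalSum-inside-inside sg σ τ) (intervalSum-alternating σ τ σ⊆τ)
    intervalSum-alternating (outside ∷ σ) (inside ∷ τ)  σ⊆τ = begin
      intervalSum sg (outside ∷ σ) (inside ∷ τ)      ≈⟨ intervalSum-outside-inside sg σ τ ⟩
      intervalSum sg σ τ + intervalSum (λ r → sg (suc r)) σ τ
        ≈⟨ +-congˡ (ΣSubsets-cong (λ ρ → if-cong (σ ⊆ᵇ ρ ∧ ρ ⊆ᵇ τ) (λ _ → sg-suc ∣ τ ─ ρ ∣))) ⟩
      intervalSum sg σ τ + intervalSum (λ r → - sg r) σ τ ≈⟨ +-congˡ (intervalSum-neg sg σ τ) ⟩
      intervalSum sg σ τ - intervalSum sg σ τ          ≈⟨ -‿inverseʳ _ ⟩
      0# ∎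

    möbius-inversion : ∀ {n} (G E : Subset n → Carrier) (τ : Subset n) →
                       (∀ σ → σ ⊆ᵇ τ ≡ true → E σ ≈ ΣSubsets (λ ρ → if ρ ⊆ᵇ σ then G ρ else 0#)) →
                       G τ ≈ ΣSubsets (λ σ → if σ ⊆ᵇ τ then sg ∣ τ ─ σ ∣ * E σ else 0#)
    möbius-inversion {n} G E τ E≈ΣG = begin
      G τ                                               ≈⟨ ΣSubsets-≡ᵇ τ G ⟨
      ΣSubsets (λ ρ → if ρ ≡ᵇ τ then G ρ else 0#)      ≈⟨ ΣSubsets-cong collapse ⟨
      ΣSubsets (λ ρ → ΣSubsets (λ σ → term ρ σ))        ≈⟨ ΣSubsets-swap term ⟩
      ΣSubsets (λ σ → ΣSubsets (λ ρ → term ρ σ))        ≈⟨ ΣSubsets-cong regroup ⟩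
      ΣSubsets (λ σ → if σ ⊆ᵇ τ then sg ∣ τ ─ σ ∣ * E σ else 0#) ∎
      where
      term : Subset n → Subset n → Carrier
      term ρ σ = if σ ⊆ᵇ τ then sg ∣ τ ─ σ ∣ * (if ρ ⊆ᵇ σ then G ρ else 0#) else 0#

      factor : ∀ b₁ b₂ (x y : Carrier) →
               (if b₁ then x * (if b₂ then y else 0#) else 0#) ≈ (if b₂ ∧ b₁ then x else 0#) * y
      factor false false x y = sym (zeroˡ y)
      factor false true  x y = sym (zeroˡ y)
      factor true  false x y = trans (zeroʳ x) (sym (zeroˡ y))
      factor true  true  x y = refl

      collapse : ∀ ρ → ΣSubsets (λ σ → term ρ σ) ≈ (if ρ ≡ᵇ τ then G ρ else 0#)
      collapse ρ = trans (ΣSubsets-cong (λ σ → factor (σ ⊆ᵇ τ) (ρ ⊆ᵇ σ) _ _))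
                         (trans (ΣSubsets-*ʳ {n} (G ρ) _) (by-cases (ρ ⊆ᵇ τ) ≡.refl))
        where
        by-cases : ∀ b → ρ ⊆ᵇ τ ≡ b → intervalSum sg ρ τ * G ρ ≈ (if ρ ≡ᵇ τ then G ρ else 0#)
        by-cases true  ρ⊆τ = trans (*-congʳ (intervalSum-alternating ρ τ ρ⊆τ)) (unit (ρ ≡ᵇ τ))
          where
          unit : ∀ b → (if b then 1# else 0#) * G ρ ≈ (if b then G ρ else 0#)
          unit true  = *-identityˡ _
          unit false = zeroˡ _
        by-cases false ρ⊈τ rewrite p⊈ᵇq⇒p≢ᵇq ρ τ ρ⊈τ =
          trans (*-congʳ (intervalSum-⊈ sg ρ τ ρ⊈τ)) (zeroˡ _)

      regroup : ∀ σ → ΣSubsets (λ ρ → term ρ σ) ≈ (if σ ⊆ᵇ τ then sg ∣ τ ─ σ ∣ * E σ else 0#)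
      regroup σ = trans (sym (if-ΣSubsets {n} (σ ⊆ᵇ τ) _))
        (if-cong (σ ⊆ᵇ τ) (λ σ⊆τ → trans (ΣSubsets-*ˡ {n} _ _) (*-congˡ (sym (E≈ΣG σ σ⊆τ)))))

module OrderedFieldProperties {c ℓ₁ ℓ₂ : Level} (F : OrderedField c ℓ₁ ℓ₂) where
  open OrderedField F
  open import Algebra.Properties.CommutativeSemigroup *-commutativeSemigroup using (x∙yz≈y∙xz)
  open import Relation.Binary.Reasoning.Setoid setoid

  x*[x⁻¹*y]≈y : ∀ x y → ¬ (x ≈ 0#) → x * (x ⁻¹ * y) ≈ y
  x*[x⁻¹*y]≈y x y x≉0 = trans (sym (*-assoc _ _ _)) (trans (*-congʳ (⁻¹-inverseʳ x x≉0)) (*-identityˡ y))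

  *-cancelˡ-≉0 : ∀ x {a b} → ¬ (x ≈ 0#) → x * a ≈ x * b → a ≈ b
  *-cancelˡ-≉0 x {a} {b} x≉0 xa≈xb = begin
    a                ≈⟨ x*[x⁻¹*y]≈y x a x≉0 ⟨
    x * (x ⁻¹ * a)   ≈⟨ x∙yz≈y∙xz x (x ⁻¹) a ⟩
    x ⁻¹ * (x * a)   ≈⟨ *-congˡ xa≈xb ⟩
    x ⁻¹ * (x * b)   ≈⟨ x∙yz≈y∙xz (x ⁻¹) x b ⟩
    x * (x ⁻¹ * b)   ≈⟨ x*[x⁻¹*y]≈y x b x≉0 ⟩
    b ∎

module ComplexProperties {c ℓ₁ ℓ₂ : Level} (F : OrderedField c ℓ₁ ℓ₂) {n : ℕ} (d : ℕ)
                         (top : List (Subset n)) (Π : Subset n → OrderedField.Carrier F) where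
  open OrderedField F
  open Complex F d top Π
  open Sums commutativeRing
  open SubsetBool
  open Binomial using ([1+m]*[1+m+j]Cj≡[1+m+j]*[m+j]Cj)
  open OrderedFieldProperties F
  open import Algebra.Properties.Ring ring using (-0#≈0#; xyx⁻¹≈y)
  open import Algebra.Properties.CommutativeSemigroup *-commutativeSemigroup using (x∙yz≈y∙xz)
  open import Data.Bool using (Bool; true; false; if_then_else_; _∧_)
  open import Data.Bool.Properties using (∧-identityʳ)
  open import Data.Empty using (⊥-elim)
  open import Data.Nat as ℕ using (zero; s≤s)
  import Data.Nat.Properties as ℕ
  open import Data.Nat.Combinatorics using (_C_; nCn≡1)
  open import Data.List.Relation.Unary.Any as Any using (Any; any?)
  open import Data.Fin.Subset using (_⊆_)
  open import Data.Fin.Subset.Properties using (_⊆?_; ⊆-trans; p⊆q⇒∣p∣≤∣q∣)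
  open import Data.Product using (proj₁; proj₂)
  open import Relation.Nullary using (Dec; yes; no)
  open import Relation.Nullary.Decidable using (⌊_⌋; _×-dec_)
  open import Relation.Binary.Structures using (IsStrictTotalOrder)
  import Relation.Binary.PropositionalEquality as ≡
  open import Relation.Binary.Reasoning.Setoid setoid

  private
    module STO = IsStrictTotalOrder isStrictTotalOrder

    ⌊⌋≡true⇒ : ∀ {a} {A : Set a} (a? : Dec A) → ⌊ a? ⌋ ≡ true → A
    ⌊⌋≡true⇒ (yes a) _ = a

    ⌊⌋≡true⇐ : ∀ {a} {A : Set a} (a? : Dec A) → A → ⌊ a? ⌋ ≡ true
    ⌊⌋≡true⇐ (yes _) _ = ≡.refl
    ⌊⌋≡true⇐ (no ¬a) a = ⊥-elim (¬a a)

    ∧≡true⇒ˡ : ∀ b {b′} → b ∧ b′ ≡ true → b ≡ true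
    ∧≡true⇒ˡ true _ = ≡.refl

  ι-+ : ∀ a b → ι (a ℕ.+ b) ≈ ι a + ι b
  ι-+ zero    b = sym (+-identityˡ _)
  ι-+ (suc a) b = trans (+-congˡ (ι-+ a b)) (sym (+-assoc _ _ _))

  ι-* : ∀ a b → ι (a ℕ.* b) ≈ ι a * ι b
  ι-* zero    b = sym (zeroˡ _)
  ι-* (suc a) b = begin
    ι (b ℕ.+ a ℕ.* b)        ≈⟨ ι-+ b (a ℕ.* b) ⟩
    ι b + ι (a ℕ.* b)        ≈⟨ +-congˡ (ι-* a b) ⟩
    ι b + ι a * ι b          ≈⟨ +-congʳ (*-identityˡ _) ⟨
    1# * ι b + ι a * ι b     ≈⟨ distribʳ _ _ _ ⟨
    (1# + ι a) * ι b ∎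

  ι1≈1 : ι 1 ≈ 1#
  ι1≈1 = +-identityʳ _

  0<ι[1+m] : ∀ m → 0# < ι (suc m)
  0<ι[1+m] zero    = STO.<-respʳ-≈ (sym ι1≈1) 0<1
  0<ι[1+m] (suc m) = STO.trans (STO.<-respʳ-≈ (sym (+-identityˡ 1#)) 0<1)
                               (STO.<-respʳ-≈ (+-comm _ _) (+-monoˡ-< 1# (0<ι[1+m] m)))

  ι[1+m]≉0 : ∀ m → ¬ (ι (suc m) ≈ 0#)
  ι[1+m]≉0 m ι≈0 = STO.irrefl (sym ι≈0) (0<ι[1+m] m)

  sumTo-cong< : ∀ m {x y : ℕ → Carrier} → (∀ j → j ℕ.< m → x j ≈ y j) → sumTo m x ≈ sumTo m y
  sumTo-cong< zero    _   = refl
  sumTo-cong< (suc m) x≈y = +-cong (sumTo-cong< m (λ j j<m → x≈y j (ℕ.m<n⇒m<1+n j<m))) (x≈y m (ℕ.n<1+n m))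

  sumTo-cong : ∀ m {x y : ℕ → Carrier} → (∀ j → x j ≈ y j) → sumTo m x ≈ sumTo m y
  sumTo-cong m x≈y = sumTo-cong< m (λ j _ → x≈y j)

  sumTo-zero< : ∀ m {x : ℕ → Carrier} → (∀ j → j ℕ.< m → x j ≈ 0#) → sumTo m x ≈ 0#
  sumTo-zero< zero    _   = refl
  sumTo-zero< (suc m) x≈0 =
    trans (+-cong (sumTo-zero< m (λ j j<m → x≈0 j (ℕ.m<n⇒m<1+n j<m))) (x≈0 m (ℕ.n<1+n m))) (+-identityˡ 0#)

  sumTo-ΣSubsets : ∀ m (h : ℕ → Subset n → Carrier) →
                   sumTo m (λ j → ΣSubsets (h j)) ≈ ΣSubsets (λ s → sumTo m (λ j → h j s))
  sumTo-ΣSubsets zero    h = sym (ΣSubsets-zero n)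
  sumTo-ΣSubsets (suc m) h = trans (+-congʳ (sumTo-ΣSubsets m h)) (sym (ΣList-+ (allSubsets n) _ _))

  sumTo-*ˡ : ∀ m a (x : ℕ → Carrier) → a * sumTo m x ≈ sumTo m (λ j → a * x j)
  sumTo-*ˡ zero    a x = zeroʳ a
  sumTo-*ˡ (suc m) a x = trans (distribˡ _ _ _) (+-congʳ (sumTo-*ˡ m a x))

  if-sumTo : (b : Bool) (m : ℕ) (x : ℕ → Carrier) → (if b then sumTo m x else 0#) ≈ sumTo m (λ j → if b then x j else 0#)
  if-sumTo true  m x = refl
  if-sumTo false m x = sym (sumTo-zero< m (λ _ _ → refl))

  sumTo-≟ : ∀ m a (x : ℕ → Carrier) → a ℕ.< m → sumTo m (λ j → if ⌊ a ℕ.≟ j ⌋ then x j else 0#) ≈ x a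
  sumTo-≟ (suc m) a x a<1+m with a ℕ.≟ m
  ... | yes ≡.refl = trans (+-congʳ (sumTo-zero< m below)) (+-identityˡ _)
    where
    below : ∀ j → j ℕ.< a → (if ⌊ a ℕ.≟ j ⌋ then x j else 0#) ≈ 0#
    below j j<a with a ℕ.≟ j
    ... | yes ≡.refl = ⊥-elim (ℕ.n≮n a j<a)
    ... | no _       = refl
  ... | no a≢m = trans (+-identityʳ _) (sumTo-≟ m a x (ℕ.≤∧≢⇒< (ℕ.≤-pred a<1+m) a≢m))

  Face : Subset n → Set
  Face τ = Any (τ ⊆_) top

  Face-⊆ : ∀ {s τ} → Face τ → s ⊆ τ → Face s
  Face-⊆ τ∈X s⊆τ = Any.map (⊆-trans s⊆τ) τ∈X

  faceᵇ-sound : ∀ i s → faceᵇ i s ≡ true → IsFace i s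
  faceᵇ-sound i s = ⌊⌋≡true⇒ ((∣ s ∣ ℕ.≟ i) ×-dec any? (s ⊆?_) top)

  ⊆ᵇ⇒⊆ : ∀ (s τ : Subset n) → s ⊆ᵇ τ ≡ true → s ⊆ τ
  ⊆ᵇ⇒⊆ s τ s⊆τ = ⌊⌋≡true⇒ (s ⊆? τ) (≡.trans (⌊⊆?⌋≡⊆ᵇ s τ) s⊆τ)

  faceᵇ-below : ∀ i s τ → Face τ → s ⊆ᵇ τ ≡ true → faceᵇ i s ≡ ⌊ ∣ s ∣ ℕ.≟ i ⌋
  faceᵇ-below i s τ τ∈X s⊆τ = ≡.trans (⌊×-dec⌋ (∣ s ∣ ℕ.≟ i) (any? (s ⊆?_) top))
    (≡.trans (≡.cong (⌊ ∣ s ∣ ℕ.≟ i ⌋ ∧_) (⌊⌋≡true⇐ (any? (s ⊆?_) top) (Face-⊆ τ∈X (⊆ᵇ⇒⊆ s τ s⊆τ))))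
             (∧-identityʳ _))
    where
    ⌊×-dec⌋ : ∀ {a b} {A : Set a} {B : Set b} (a? : Dec A) (b? : Dec B) → ⌊ a? ×-dec b? ⌋ ≡ ⌊ a? ⌋ ∧ ⌊ b? ⌋
    ⌊×-dec⌋ (yes _) (yes _) = ≡.refl
    ⌊×-dec⌋ (yes _) (no _)  = ≡.refl
    ⌊×-dec⌋ (no _)  (yes _) = ≡.refl
    ⌊×-dec⌋ (no _)  (no _)  = ≡.refl

  U-cong : ∀ j {h h′ : Fn} → (∀ s → h s ≈ h′ s) → ∀ τ → U j h τ ≈ U j h′ τ
  U-cong j h≈h′ τ = *-congˡ (ΣSubsets-cong (λ σ → if-cong (faceᵇ j σ ∧ subᵇ σ τ) (λ _ → h≈h′ σ)))

  Upow-cong : ∀ m j {h h′ : Fn} → (∀ s → h s ≈ h′ s) → ∀ τ → Upow m j h τ ≈ Upow m j h′ τ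
  Upow-cong zero    j h≈h′ = h≈h′
  Upow-cong (suc m) j h≈h′ = Upow-cong m (suc j) (U-cong j h≈h′)

  U-cong-faces : ∀ j {h h′ : Fn} → (∀ σ → IsFace j σ → h σ ≈ h′ σ) → ∀ τ → U j h τ ≈ U j h′ τ
  U-cong-faces j h≈h′ τ = *-congˡ (ΣSubsets-cong (λ σ → if-cong (faceᵇ j σ ∧ subᵇ σ τ)
    (λ σ∈X → h≈h′ σ (faceᵇ-sound j σ (∧≡true⇒ˡ (faceᵇ j σ) σ∈X)))))

  Upow-cong-faces : ∀ m j {h h′ : Fn} → (∀ σ → IsFace j σ → h σ ≈ h′ σ) →
                    ∀ τ → Face τ → ∣ τ ∣ ≡ m ℕ.+ j → Upow m j h τ ≈ Upow m j h′ τ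
  Upow-cong-faces zero    j h≈h′ τ τ∈X ∣τ∣≡j   = h≈h′ τ (∣τ∣≡j , τ∈X)
  Upow-cong-faces (suc m) j h≈h′ τ τ∈X ∣τ∣≡m+j =
    Upow-cong-faces m (suc j) (λ σ _ → U-cong-faces j h≈h′ σ) τ τ∈X (≡.trans ∣τ∣≡m+j (≡.sym (ℕ.+-suc m j)))

  U-linear : ∀ j p (a : ℕ → Carrier) (H : ℕ → Fn) τ →
             U j (λ s → sumTo p (λ l → a l * H l s)) τ ≈ sumTo p (λ l → a l * U j (H l) τ)
  U-linear j p a H τ = begin
    ι (suc j) ⁻¹ * ΣSubsets (λ σ → if B σ then sumTo p (λ l → a l * H l σ) else 0#)
      ≈⟨ *-congˡ (ΣSubsets-cong (λ σ → trans (if-sumTo (B σ) p _) (sumTo-cong p (λ l → sym (if-*ˡ (B σ) _ _))))) ⟩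
    ι (suc j) ⁻¹ * ΣSubsets (λ σ → sumTo p (λ l → a l * (if B σ then H l σ else 0#)))
      ≈⟨ *-congˡ (sumTo-ΣSubsets p _) ⟨
    ι (suc j) ⁻¹ * sumTo p (λ l → ΣSubsets (λ σ → a l * (if B σ then H l σ else 0#)))
      ≈⟨ *-congˡ (sumTo-cong p (λ l → ΣSubsets-*ˡ {n} (a l) _)) ⟩
    ι (suc j) ⁻¹ * sumTo p (λ l → a l * ΣFace j (λ σ → subᵇ σ τ) (H l))
      ≈⟨ sumTo-*ˡ p _ _ ⟩
    sumTo p (λ l → ι (suc j) ⁻¹ * (a l * ΣFace j (λ σ → subᵇ σ τ) (H l)))
      ≈⟨ sumTo-cong p (λ l → x∙yz≈y∙xz _ _ _) ⟩
    sumTo p (λ l → a l * U j (H l) τ) ∎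
    where
    B : Subset n → Bool
    B σ = faceᵇ j σ ∧ subᵇ σ τ

  Upow-linear : ∀ m j p (a : ℕ → Carrier) (H : ℕ → Fn) τ →
                Upow m j (λ s → sumTo p (λ l → a l * H l s)) τ ≈ sumTo p (λ l → a l * Upow m j (H l) τ)
  Upow-linear zero    j p a H τ = refl
  Upow-linear (suc m) j p a H τ =
    trans (Upow-cong m (suc j) (U-linear j p a H) τ) (Upow-linear m (suc j) p a (λ l → U j (H l)) τ)

  Upow-+ : ∀ a b j (h : Fn) τ → Upow b (a ℕ.+ j) (Upow a j h) τ ≡ Upow (a ℕ.+ b) j h τ
  Upow-+ zero    b j h τ = ≡.refl
  Upow-+ (suc a) b j h τ =
    ≡.trans (≡.cong (λ i → Upow b i (Upow a (suc j) (U j h)) τ) (≡.sym (ℕ.+-suc a j)))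
            (Upow-+ a b (suc j) (U j h) τ)

  Upow-suc : ∀ m j (h : Fn) τ → Upow (suc m) j h τ ≡ U (m ℕ.+ j) (Upow m j h) τ
  Upow-suc zero    j h τ = ≡.refl
  Upow-suc (suc m) j h τ =
    ≡.trans (Upow-suc m (suc j) (U j h) τ) (≡.cong (λ i → U i (Upow (suc m) j h) τ) (ℕ.+-suc m j))

  Uˢ-∘ : ∀ {i j k} (h : Fn) τ → j ℕ.≤ i → i ℕ.≤ k → Uˢ k i (Uˢ i j h) τ ≡ Uˢ k j h τ
  Uˢ-∘ {i} {j} {k} h τ j≤i i≤k =
    ≡.trans (≡.cong (λ l → Upow (k ∸ i) l (Uˢ i j h) τ) (≡.sym (ℕ.m∸n+n≡m j≤i)))
    (≡.trans (Upow-+ (i ∸ j) (k ∸ i) j h τ) (≡.cong (λ l → Upow l j h τ) [i∸j]+[k∸i]≡k∸j))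
    where
    [i∸j]+[k∸i]≡k∸j : i ∸ j ℕ.+ (k ∸ i) ≡ k ∸ j
    [i∸j]+[k∸i]≡k∸j = ≡.sym (≡.trans (≡.cong (_∸ j) (≡.sym (ℕ.m∸n+n≡m i≤k)))
                                     (≡.trans (ℕ.+-∸-assoc (k ∸ i) j≤i) (ℕ.+-comm (k ∸ i) (i ∸ j))))

  Uˢ-refl : ∀ i (h : Fn) τ → Uˢ i i h τ ≡ h τ
  Uˢ-refl i h τ rewrite ℕ.n∸n≡0 i = ≡.refl

  ΣBelow : ℕ → Fn → Subset n → Carrier
  ΣBelow j h τ = ΣSubsets (λ σ → if faceᵇ j σ ∧ σ ⊆ᵇ τ then h σ else 0#)

  ΣFace-⊆?≈ΣBelow : ∀ j h τ → ΣFace j (λ σ → subᵇ σ τ) h ≈ ΣBelow j h τ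
  ΣFace-⊆?≈ΣBelow j h τ =
    ΣSubsets-cong (λ σ → reflexive (≡.cong (λ b → if faceᵇ j σ ∧ b then h σ else 0#) (⌊⊆?⌋≡⊆ᵇ σ τ)))

  ΣBelow-cong-faces : ∀ j τ {h h′ : Fn} → (∀ σ → IsFace j σ → h σ ≈ h′ σ) → ΣBelow j h τ ≈ ΣBelow j h′ τ
  ΣBelow-cong-faces j τ h≈h′ = ΣSubsets-cong (λ σ → if-cong (faceᵇ j σ ∧ σ ⊆ᵇ τ)
    (λ σ∈X → h≈h′ σ (faceᵇ-sound j σ (∧≡true⇒ˡ (faceᵇ j σ) σ∈X))))

  ΣBelow-*ˡ : ∀ j a (h : Fn) τ → a * ΣBelow j h τ ≈ ΣBelow j (λ σ → a * h σ) τ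
  ΣBelow-*ˡ j a h τ = trans (sym (ΣSubsets-*ˡ {n} a _)) (ΣSubsets-cong (λ σ → if-*ˡ (faceᵇ j σ ∧ σ ⊆ᵇ τ) a _))

  ΣBelow-self : ∀ j h τ → Face τ → ∣ τ ∣ ≡ j → ΣBelow j h τ ≈ h τ
  ΣBelow-self j h τ τ∈X ∣τ∣≡j = trans (ΣSubsets-cong only-τ) (ΣSubsets-≡ᵇ τ h)
    where
    only-τ : ∀ σ → (if faceᵇ j σ ∧ σ ⊆ᵇ τ then h σ else 0#) ≈ (if σ ≡ᵇ τ then h σ else 0#)
    only-τ σ with σ ⊆ᵇ τ in σ⊆τ
    ... | false rewrite p⊈ᵇq⇒p≢ᵇq σ τ σ⊆τ = if-∧-false (faceᵇ j σ) _
    ... | true rewrite faceᵇ-below j σ τ τ∈X σ⊆τ | ∧-identityʳ ⌊ ∣ σ ∣ ℕ.≟ j ⌋ with ∣ σ ∣ ℕ.≟ j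
    ...   | no ∣σ∣≢j
              rewrite ∣p∣≢∣q∣⇒p≢ᵇq σ τ (λ ∣σ∣≡∣τ∣ → ∣σ∣≢j (≡.trans ∣σ∣≡∣τ∣ ∣τ∣≡j)) = refl
    ...   | yes ∣σ∣≡j
              rewrite p⊆ᵇq∧∣q─p∣≡0⇒p≡ᵇq σ τ σ⊆τ
                (≡.trans (∣q─p∣≡∣q∣∸∣p∣ σ τ σ⊆τ) (≡.trans (≡.cong₂ _∸_ ∣τ∣≡j ∣σ∣≡j) (ℕ.n∸n≡0 j))) = refl

  δ₁-complement : ∀ a r N (x : Carrier) → a ℕ.+ r ≡ suc N → (if ⌊ r ℕ.≟ N ⌋ then x else 0#) ≈ δ₁ a * x
  δ₁-complement a r N x a+r≡1+N with r ℕ.≟ N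
  δ₁-complement zero          r N x a+r≡1+N | yes r≡N  = ⊥-elim (ℕ.1+n≢n (≡.trans (≡.sym a+r≡1+N) r≡N))
  δ₁-complement (suc zero)    r N x a+r≡1+N | yes _    = sym (*-identityˡ x)
  δ₁-complement (suc (suc a)) r N x a+r≡1+N | yes ≡.refl = ⊥-elim (ℕ.m≢1+n+m r (≡.sym (ℕ.suc-injective a+r≡1+N)))
  δ₁-complement zero          r N x a+r≡1+N | no _     = sym (zeroˡ x)
  δ₁-complement (suc zero)    r N x a+r≡1+N | no r≢N   = ⊥-elim (r≢N (ℕ.suc-injective a+r≡1+N))
  δ₁-complement (suc (suc a)) r N x a+r≡1+N | no _     = sym (zeroˡ x)

  ΣFacesBetween : ∀ m j σ τ (x : Carrier) → Face τ → ∣ τ ∣ ≡ suc (m ℕ.+ j) → ∣ σ ∣ ≡ j → σ ⊆ᵇ τ ≡ true →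
    ΣSubsets (λ ρ → if faceᵇ (m ℕ.+ j) ρ ∧ ρ ⊆ᵇ τ then (if σ ⊆ᵇ ρ then x else 0#) else 0#) ≈ ι (suc m) * x
  ΣFacesBetween m j σ τ x τ∈X ∣τ∣≡1+m+j ∣σ∣≡j σ⊆τ = begin
    _                                                                  ≈⟨ ΣSubsets-cong indicator ⟩
    ΣSubsets (λ ρ → (if σ ⊆ᵇ ρ ∧ ρ ⊆ᵇ τ then δ₁ ∣ τ ─ ρ ∣ else 0#) * x) ≈⟨ ΣSubsets-*ʳ {n} x _ ⟩
    intervalSum δ₁ σ τ * x  ≈⟨ *-congʳ (intervalSum-δ₁ ι refl (λ _ → refl) σ τ σ⊆τ) ⟩
    ι ∣ τ ─ σ ∣ * x         ≡⟨ ≡.cong (λ a → ι a * x) ∣τ─σ∣≡1+m ⟩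
    ι (suc m) * x ∎
    where
    N = m ℕ.+ j
    ∣τ─σ∣≡1+m : ∣ τ ─ σ ∣ ≡ suc m
    ∣τ─σ∣≡1+m = ≡.trans (∣q─p∣≡∣q∣∸∣p∣ σ τ σ⊆τ)
                        (≡.trans (≡.cong₂ _∸_ ∣τ∣≡1+m+j ∣σ∣≡j) (ℕ.m+n∸n≡m (suc m) j))
    indicator : ∀ ρ → (if faceᵇ N ρ ∧ ρ ⊆ᵇ τ then (if σ ⊆ᵇ ρ then x else 0#) else 0#)
                      ≈ (if σ ⊆ᵇ ρ ∧ ρ ⊆ᵇ τ then δ₁ ∣ τ ─ ρ ∣ else 0#) * x
    indicator ρ with ρ ⊆ᵇ τ in ρ⊆τ | σ ⊆ᵇ ρ
    ... | false | b     = trans (if-∧-false (faceᵇ N ρ) _) (sym (trans (*-congʳ (if-∧-false b _)) (zeroˡ x)))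
    ... | true  | false = trans (if-zero (faceᵇ N ρ ∧ true)) (sym (zeroˡ x))
    ... | true  | true rewrite faceᵇ-below N ρ τ τ∈X ρ⊆τ | ∧-identityʳ ⌊ ∣ ρ ∣ ℕ.≟ N ⌋ =
      δ₁-complement ∣ τ ─ ρ ∣ ∣ ρ ∣ N x (≡.trans (∣q─p∣+∣p∣≡∣q∣ ρ τ ρ⊆τ) ∣τ∣≡1+m+j)

  ΣBelow-ΣBelow : ∀ m j (h : Fn) τ → Face τ → ∣ τ ∣ ≡ suc (m ℕ.+ j) →
                  ΣBelow (m ℕ.+ j) (ΣBelow j h) τ ≈ ι (suc m) * ΣBelow j h τ
  ΣBelow-ΣBelow m j h τ τ∈X ∣τ∣≡1+m+j = begin
    ΣBelow N (ΣBelow j h) τ                   ≈⟨ ΣSubsets-cong (λ ρ → if-ΣSubsets {n} (faceᵇ N ρ ∧ ρ ⊆ᵇ τ) _) ⟩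
    ΣSubsets (λ ρ → ΣSubsets (λ σ → term ρ σ)) ≈⟨ ΣSubsets-swap term ⟩
    ΣSubsets (λ σ → ΣSubsets (λ ρ → term ρ σ)) ≈⟨ ΣSubsets-cong count ⟩
    ΣSubsets (λ σ → ι (suc m) * (if faceᵇ j σ ∧ σ ⊆ᵇ τ then h σ else 0#)) ≈⟨ ΣSubsets-*ˡ {n} _ _ ⟩
    ι (suc m) * ΣBelow j h τ ∎
    where
    N = m ℕ.+ j
    term : Subset n → Subset n → Carrier
    term ρ σ = if faceᵇ N ρ ∧ ρ ⊆ᵇ τ then (if faceᵇ j σ ∧ σ ⊆ᵇ ρ then h σ else 0#) else 0#

    count : ∀ σ → ΣSubsets (λ ρ → term ρ σ) ≈ ι (suc m) * (if faceᵇ j σ ∧ σ ⊆ᵇ τ then h σ else 0#)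
    count σ with σ ⊆ᵇ τ in σ⊆τ
    ... | false = trans (ΣSubsets-cong vanish)
                        (trans (ΣSubsets-zero n) (sym (trans (*-congˡ (if-∧-false (faceᵇ j σ) _)) (zeroʳ _))))
      where
      vanish : ∀ ρ → term ρ σ ≈ 0#
      vanish ρ with ρ ⊆ᵇ τ in ρ⊆τ | σ ⊆ᵇ ρ in σ⊆ρ
      ... | false | _     = if-∧-false (faceᵇ N ρ) _
      ... | true  | false = trans (if-cong (faceᵇ N ρ ∧ true) (λ _ → if-∧-false (faceᵇ j σ) _)) (if-zero _)
      ... | true  | true  with ≡.trans (≡.sym (⊆ᵇ-trans σ ρ τ σ⊆ρ ρ⊆τ)) σ⊆τ
      ...   | ()
    ... | true with faceᵇ j σ in σ∈X
    ...   | true  = ΣFacesBetween m j σ τ (h σ) τ∈X ∣τ∣≡1+m+j (proj₁ (faceᵇ-sound j σ σ∈X)) σ⊆τ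
    ...   | false = trans (ΣSubsets-cong (λ ρ → if-zero (faceᵇ N ρ ∧ ρ ⊆ᵇ τ)))
                          (trans (ΣSubsets-zero n) (sym (zeroʳ _)))

  bin-Upow≈ΣBelow : ∀ m j (h : Fn) τ → Face τ → ∣ τ ∣ ≡ m ℕ.+ j →
                    ι ((m ℕ.+ j) C j) * Upow m j h τ ≈ ΣBelow j h τ
  bin-Upow≈ΣBelow zero j h τ τ∈X ∣τ∣≡j = begin
    ι (j C j) * h τ  ≡⟨ ≡.cong (λ a → ι a * h τ) (nCn≡1 j) ⟩
    ι 1 * h τ        ≈⟨ *-congʳ ι1≈1 ⟩
    1# * h τ         ≈⟨ *-identityˡ _ ⟩
    h τ              ≈⟨ ΣBelow-self j h τ τ∈X ∣τ∣≡j ⟨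
    ΣBelow j h τ ∎
  bin-Upow≈ΣBelow (suc m) j h τ τ∈X ∣τ∣≡1+m+j = *-cancelˡ-≉0 (ι (suc m)) (ι[1+m]≉0 m) (begin
    ι (suc m) * (ι (suc N C j) * u)       ≈⟨ *-assoc _ _ _ ⟨
    ι (suc m) * ι (suc N C j) * u         ≈⟨ *-congʳ (ι-* (suc m) (suc N C j)) ⟨
    ι (suc m ℕ.* (suc N C j)) * u         ≡⟨ ≡.cong (λ a → ι a * u) ([1+m]*[1+m+j]Cj≡[1+m+j]*[m+j]Cj m j) ⟩
    ι (suc N ℕ.* (N C j)) * u             ≈⟨ *-congʳ (trans (ι-* (suc N) (N C j)) (*-comm _ _)) ⟩
    ι (N C j) * ι (suc N) * u             ≈⟨ *-assoc _ _ _ ⟩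
    ι (N C j) * (ι (suc N) * u)
      ≈⟨ *-congˡ (trans (*-congˡ (reflexive (Upow-suc m j h τ))) (x*[x⁻¹*y]≈y _ _ (ι[1+m]≉0 N))) ⟩
    ι (N C j) * ΣFace N (λ ρ → subᵇ ρ τ) (Upow m j h) ≈⟨ *-congˡ (ΣFace-⊆?≈ΣBelow N (Upow m j h) τ) ⟩
    ι (N C j) * ΣBelow N (Upow m j h) τ   ≈⟨ ΣBelow-*ˡ N (ι (N C j)) (Upow m j h) τ ⟩
    ΣBelow N (λ ρ → ι (N C j) * Upow m j h ρ) τ
      ≈⟨ ΣBelow-cong-faces N τ (λ ρ ρ∈X → bin-Upow≈ΣBelow m j h ρ (proj₂ ρ∈X) (proj₁ ρ∈X)) ⟩
    ΣBelow N (ΣBelow j h) τ               ≈⟨ ΣBelow-ΣBelow m j h τ τ∈X ∣τ∣≡1+m+j ⟩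
    ι (suc m) * ΣBelow j h τ ∎)
    where
    N = m ℕ.+ j
    u = Upow (suc m) j h τ

  bin-Uˢ≈ΣBelow : ∀ i j (h : Fn) τ → Face τ → ∣ τ ∣ ≡ i → j ℕ.≤ i → bin i j * Uˢ i j h τ ≈ ΣBelow j h τ
  bin-Uˢ≈ΣBelow i j h τ τ∈X ∣τ∣≡i j≤i =
    trans (*-congʳ (reflexive (≡.cong (λ a → ι (a C j)) (≡.sym (ℕ.m∸n+n≡m j≤i)))))
          (bin-Upow≈ΣBelow (i ∸ j) j h τ τ∈X (≡.trans ∣τ∣≡i (≡.sym (ℕ.m∸n+n≡m j≤i))))

  sumTo-ΣBelow : ∀ i τ → Face τ → ∣ τ ∣ ≡ i → (H : ℕ → Fn) →
                 sumTo (suc i) (λ j → ΣBelow j (H j) τ) ≈ ΣSubsets (λ σ → if σ ⊆ᵇ τ then H ∣ σ ∣ σ else 0#)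
  sumTo-ΣBelow i τ τ∈X ∣τ∣≡i H = trans (sumTo-ΣSubsets (suc i) _) (ΣSubsets-cong level-of)
    where
    level-of : ∀ σ → sumTo (suc i) (λ j → if faceᵇ j σ ∧ σ ⊆ᵇ τ then H j σ else 0#)
                     ≈ (if σ ⊆ᵇ τ then H ∣ σ ∣ σ else 0#)
    level-of σ with σ ⊆ᵇ τ in σ⊆τ
    ... | false = sumTo-zero< (suc i) (λ j _ → if-∧-false (faceᵇ j σ) _)
    ... | true  = trans (sumTo-cong (suc i) (λ j → reflexive (≡.cong (λ b → if b then H j σ else 0#)
                          (≡.trans (≡.cong (_∧ true) (faceᵇ-below j σ τ τ∈X σ⊆τ)) (∧-identityʳ _)))))
                        (sumTo-≟ (suc i) ∣ σ ∣ (λ j → H j σ)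
                          (s≤s (≡.subst (∣ σ ∣ ℕ.≤_) ∣τ∣≡i (p⊆q⇒∣p∣≤∣q∣ (⊆ᵇ⇒⊆ σ τ σ⊆τ)))))

  ΣSub-⊆?≈ΣSubsets-⊆ᵇ : ∀ τ (φ : Fn) →
                        ΣSub (λ σ → subᵇ σ τ) φ ≈ ΣSubsets (λ σ → if σ ⊆ᵇ τ then φ σ else 0#)
  ΣSub-⊆?≈ΣSubsets-⊆ᵇ τ φ =
    ΣSubsets-cong (λ σ → reflexive (≡.cong (λ b → if b then φ σ else 0#) (⌊⊆?⌋≡⊆ᵇ σ τ)))

  module BottomUpProperties (k : ℕ) (f : Fn) where
    open BottomUp k f

    g-suc : ∀ i τ → g (suc i) τ ≡
            Dˢ k (suc i) f τ - sumTo (suc i) (λ j → bin (suc i) j * Uˢ (suc i) j (gUpTo i j) τ)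
    g-suc i τ with suc i ℕ.≤? i
    ... | yes 1+i≤i = ⊥-elim (ℕ.1+n≰n 1+i≤i)
    ... | no _      = ≡.refl

    gUpTo≡g : ∀ i j τ → j ℕ.≤ i → gUpTo i j τ ≡ g j τ
    gUpTo≡g ℕ.zero  .ℕ.zero τ ℕ.z≤n = ≡.refl
    gUpTo≡g (suc i) j     τ j≤1+i with j ℕ.≤? i
    ... | yes j≤i = gUpTo≡g i j τ j≤i
    ... | no  j≰i with ℕ.≤-antisym j≤1+i (ℕ.≰⇒> j≰i)
    ...   | ≡.refl = ≡.sym (g-suc i τ)

    g-recursion : ∀ i τ → g i τ ≈ Dˢ k i f τ - sumTo i (λ j → bin i j * Uˢ i j (g j) τ)
    g-recursion zero    τ = sym (trans (+-congˡ -0#≈0#) (+-identityʳ _))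
    g-recursion (suc i) τ = trans (reflexive (g-suc i τ))
      (+-congˡ (-‿cong (sumTo-cong< (suc i) (λ j j<1+i →
        *-congˡ (Upow-cong (suc i ∸ j) j (λ σ → reflexive (gUpTo≡g i j σ (ℕ.≤-pred j<1+i))) τ)))))

    Dˢ≈Σbin-Uˢ-g : ∀ i τ → Dˢ k i f τ ≈ sumTo (suc i) (λ j → bin i j * Uˢ i j (g j) τ)
    Dˢ≈Σbin-Uˢ-g i τ = begin
      Dˢ k i f τ                       ≈⟨ xyx⁻¹≈y s (Dˢ k i f τ) ⟨
      s + Dˢ k i f τ - s               ≈⟨ +-assoc _ _ _ ⟩
      s + (Dˢ k i f τ - s)             ≈⟨ +-congˡ (g-recursion i τ) ⟨
      s + g i τ                        ≈⟨ +-congˡ bin-Uˢ-refl ⟨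
      s + bin i i * Uˢ i i (g i) τ ∎
      where
      s = sumTo i (λ j → bin i j * Uˢ i j (g j) τ)
      bin-Uˢ-refl : bin i i * Uˢ i i (g i) τ ≈ g i τ
      bin-Uˢ-refl = trans (*-cong (trans (reflexive (≡.cong ι (nCn≡1 i))) ι1≈1) (reflexive (Uˢ-refl i (g i) τ)))
                          (*-identityˡ _)

    decomposition : ∀ τ → f τ ≈ sumTo (suc k) (λ i → lift i τ)
    decomposition τ = trans (reflexive (≡.sym Dˢ-refl)) (Dˢ≈Σbin-Uˢ-g k τ)
      where
      Dˢ-refl : Dˢ k k f τ ≡ f τ
      Dˢ-refl rewrite ℕ.n∸n≡0 k = ≡.refl

    E≈Σg-below : ∀ τ → Face τ → E k f τ ≈ ΣSubsets (λ σ → if σ ⊆ᵇ τ then g ∣ σ ∣ σ else 0#)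
    E≈Σg-below τ τ∈X = trans (Dˢ≈Σbin-Uˢ-g ∣ τ ∣ τ)
      (trans (sumTo-cong< (suc ∣ τ ∣) (λ j j<1+∣τ∣ → bin-Uˢ≈ΣBelow ∣ τ ∣ j (g j) τ τ∈X ≡.refl (ℕ.≤-pred j<1+∣τ∣)))
             (sumTo-ΣBelow ∣ τ ∣ τ τ∈X ≡.refl g))

    g-möbius : ∀ i τ → IsFace i τ → g i τ ≈ ΣSubsets (λ σ → if σ ⊆ᵇ τ then sgn ∣ τ ─ σ ∣ * E k f σ else 0#)
    g-möbius i τ (∣τ∣≡i , τ∈X) = begin
      g i τ          ≡⟨ ≡.cong (λ a → g a τ) (≡.sym ∣τ∣≡i) ⟩
      g ∣ τ ∣ τ      ≈⟨ möbius-inversion sgn refl (λ _ → refl) (λ σ → g ∣ σ ∣ σ) (E k f) τ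
                          (λ σ σ⊆τ → E≈Σg-below σ (Face-⊆ τ∈X (⊆ᵇ⇒⊆ σ τ σ⊆τ))) ⟩
      ΣSubsets (λ σ → if σ ⊆ᵇ τ then sgn ∣ τ ─ σ ∣ * E k f σ else 0#) ∎

    g-alternating : ∀ i τ → IsFace i τ → g i τ ≈ sumTo (suc i) (λ j → sgn (i ∸ j) * bin i j * Uˢ i j (Dˢ k j f) τ)
    g-alternating i τ (∣τ∣≡i , τ∈X) = trans (g-möbius i τ (∣τ∣≡i , τ∈X)) (sym (begin
      sumTo (suc i) (λ j → sgn (i ∸ j) * bin i j * Uˢ i j (Dˢ k j f) τ)
        ≈⟨ sumTo-cong< (suc i) (λ j j<1+i → trans (*-assoc _ _ _)
             (trans (*-congˡ (bin-Uˢ≈ΣBelow i j _ τ τ∈X ∣τ∣≡i (ℕ.≤-pred j<1+i))) (ΣBelow-*ˡ j _ _ τ))) ⟩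
      sumTo (suc i) (λ j → ΣBelow j (λ σ → sgn (i ∸ j) * Dˢ k j f σ) τ)
        ≈⟨ sumTo-ΣBelow i τ τ∈X ∣τ∣≡i (λ j σ → sgn (i ∸ j) * Dˢ k j f σ) ⟩
      ΣSubsets (λ σ → if σ ⊆ᵇ τ then sgn (i ∸ ∣ σ ∣) * E k f σ else 0#)
        ≈⟨ ΣSubsets-cong (λ σ → if-cong (σ ⊆ᵇ τ) (λ σ⊆τ → reflexive (≡.cong (λ a → sgn a * E k f σ)
             (≡.trans (≡.cong (_∸ ∣ σ ∣) (≡.sym ∣τ∣≡i)) (≡.sym (∣q─p∣≡∣q∣∸∣p∣ σ τ σ⊆τ)))))) ⟩
      ΣSubsets (λ σ → if σ ⊆ᵇ τ then sgn ∣ τ ─ σ ∣ * E k f σ else 0#) ∎))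

    lift-alternating : ∀ i → i ℕ.≤ k → ∀ τ → IsFace k τ →
                       lift i τ ≈ bin k i * sumTo (suc i) (λ j → sgn (i ∸ j) * bin i j * Uˢ k j (Dˢ k j f) τ)
    lift-alternating i i≤k τ (∣τ∣≡k , τ∈X) = *-congˡ (begin
      Uˢ k i (g i) τ
        ≈⟨ Upow-cong-faces (k ∸ i) i (g-alternating i) τ τ∈X (≡.trans ∣τ∣≡k (≡.sym (ℕ.m∸n+n≡m i≤k))) ⟩
      Uˢ k i (λ ρ → sumTo (suc i) (λ j → sgn (i ∸ j) * bin i j * Uˢ i j (Dˢ k j f) ρ)) τ
        ≈⟨ Upow-linear (k ∸ i) i (suc i) (λ j → sgn (i ∸ j) * bin i j) (λ j → Uˢ i j (Dˢ k j f)) τ ⟩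
      sumTo (suc i) (λ j → sgn (i ∸ j) * bin i j * Uˢ k i (Uˢ i j (Dˢ k j f)) τ)
        ≈⟨ sumTo-cong< (suc i) (λ j j<1+i → *-congˡ (reflexive (Uˢ-∘ (Dˢ k j f) τ (ℕ.≤-pred j<1+i) i≤k))) ⟩
      sumTo (suc i) (λ j → sgn (i ∸ j) * bin i j * Uˢ k j (Dˢ k j f) τ) ∎)

    lift≈ΣFace-g : ∀ i → i ℕ.≤ k → ∀ τ → IsFace k τ → lift i τ ≈ ΣFace i (λ σ → subᵇ σ τ) (g i)
    lift≈ΣFace-g i i≤k τ (∣τ∣≡k , τ∈X) =
      trans (bin-Uˢ≈ΣBelow k i (g i) τ τ∈X ∣τ∣≡k i≤k) (sym (ΣFace-⊆?≈ΣBelow i (g i) τ))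

mainTheorem9 : ∀ {c ℓ₁ ℓ₂ : Level} (F : OrderedField c ℓ₁ ℓ₂) {n : ℕ} (d : ℕ)
  (top : List (Subset n)) (Π : Subset n → OrderedField.Carrier F) →
  let open OrderedField F
      open Complex F d top Π
  in ¬ (top ≡ []) →
     All (λ t → ∣ t ∣ ≡ d) top →
     (∀ t → IsFace d t → 0# < Π t) →
     ΣFace d (λ _ → true) Π ≈ 1# →
     (k : ℕ) → k ≤ d → (f : Fn) →
     let open BottomUp k f
     in (∀ τ → IsFace k τ → f τ ≈ sumTo (suc k) (λ i → lift i τ))
      × (∀ i → i ≤ k → ∀ τ → IsFace i τ →
           g i τ ≈ sumTo (suc i) (λ j → sgn (i ∸ j) * bin i j * Uˢ i j (Dˢ k j f) τ))
      × (∀ i → i ≤ k → ∀ τ → IsFace k τ →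
           lift i τ ≈ bin k i * sumTo (suc i) (λ j → sgn (i ∸ j) * bin i j * Uˢ k j (Dˢ k j f) τ))
      × (∀ i → i ≤ k → ∀ τ → IsFace i τ →
           g i τ ≈ ΣSub (λ σ → subᵇ σ τ) (λ σ → sgn ∣ τ ─ σ ∣ * E k f σ))
      × (∀ i → i ≤ k → ∀ τ → IsFace k τ →
           lift i τ ≈ ΣFace i (λ σ → subᵇ σ τ) (g i))
mainTheorem9 F d top Π _ _ _ _ k _ f =
    (λ τ _ → decomposition τ)
  , (λ i _ → g-alternating i)
  , lift-alternating
  , (λ i _ τ τ∈Xi → trans (g-möbius i τ τ∈Xi) (sym (ΣSub-⊆?≈ΣSubsets-⊆ᵇ τ _)))
  , lift≈ΣFace-g
  where
  open OrderedField F using (trans; sym)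
  open ComplexProperties F d top Π
  open BottomUpProperties k f
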